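{- Let $P$ be a signed poset on $[n]$ and let $F$ be the set of signed filters of $P$. Then $\mathcal{O}_P = \mathrm{conv}(F)$.
   Context: Let $B_n := \{\pm e_i : 1 \le i \le n\} \cup \{\pm e_i \pm e_j : 1 \le i < j \le n\} \subset \mathbb{R}^n$. For $S \subseteq B_n$, $\mathrm{PLC}(S)$ is the set of elements of $B_n$ that are positive linear combinations of elements of $S$. A signed poset on $[n]$ is a subset $P \subseteq B_n$ with (1) $\alpha \in P \Rightarrow -\alpha \notin P$, (2) $\mathrm{PLC}(P) = P$. The signed order polytope is $\mathcal{O}_P := \{x \in \mathbb{R}^n : \langle \alpha, x\rangle \ge 0 \ \forall \alpha \in P\} \cap [-1,1]^n$. A signed filter of $P$ is a point $x \in \{ -1,0,1\}^n$ with $\langle \alpha, x \rangle \ge 0$ for all $\alpha \in P$.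
   Formalization: The equality $\mathcal{O}_P = \mathrm{conv}(F)$ is asserted only for points of ℚ^n rather than $\mathbb{R}^n$, and the coefficients in positive linear combinations and convex combinations are rational. -}

module Defs where

open import Data.Nat using (ℕ)
open import Data.Fin as Fin using (Fin)
open import Data.Integer as ℤ using (ℤ; +_)
open import Data.Rational as ℚ using (ℚ; 0ℚ; 1ℚ; _/_)
open import Data.Vec using (Vec; tabulate; zipWith; map; replicate; foldr; lookup)
open import Data.List as List using (List; []; _∷_)
open import Data.List.Relation.Unary.All using (All)
open import Data.Product using (Σ; ∃; ∃-syntax; _×_; _,_)
open import Data.Sum using (_⊎_)
open import Data.Bool using (if_then_else_)
open import Relation.Nullary using (¬_; does)
open import Relation.Binary.PropositionalEquality using (_≡_)

ZVec : ℕ → Set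
ZVec n = Vec ℤ n

QVec : ℕ → Set
QVec n = Vec ℚ n

toℚ : ℤ → ℚ
toℚ z = z / 1

toℚv : ∀ {n} → ZVec n → QVec n
toℚv = map toℚ

e : ∀ {n} → Fin n → ZVec n
e i = tabulate (λ k → if does (k Fin.≟ i) then ℤ.+ 1 else ℤ.+ 0)

_·ᶻ_ : ∀ {n} → ℤ → ZVec n → ZVec n
s ·ᶻ v = map (s ℤ.*_) v

_+ᶻ_ : ∀ {n} → ZVec n → ZVec n → ZVec n
_+ᶻ_ = zipWith ℤ._+_

negᶻ : ∀ {n} → ZVec n → ZVec n
negᶻ = map (λ z → ℤ.- z)

IsSign : ℤ → Set
IsSign s = (s ≡ ℤ.+ 1) ⊎ (s ≡ ℤ.- (ℤ.+ 1))

InB : ∀ {n} → ZVec n → Set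
InB {n} v =
  (∃[ i ] ∃[ s ] (IsSign s × v ≡ s ·ᶻ e i))
  ⊎ (∃[ i ] ∃[ j ] (i Fin.< j × ∃[ s ] ∃[ t ] (IsSign s × IsSign t ×
        v ≡ (s ·ᶻ e i) +ᶻ (t ·ᶻ e j))))

_·_ : ∀ {n} → ℚ → QVec n → QVec n
c · v = map (c ℚ.*_) v

_⊕_ : ∀ {n} → QVec n → QVec n → QVec n
_⊕_ = zipWith ℚ._+_

0v : ∀ {n} → QVec n
0v = replicate _ 0ℚ

lincomb : ∀ {n} → List (ℚ × ZVec n) → QVec n
lincomb [] = 0v
lincomb ((c , v) ∷ rest) = (c · toℚv v) ⊕ lincomb rest

⟨_,_⟩ : ∀ {n} → ZVec n → QVec n → ℚ
⟨ α , x ⟩ = foldr _ ℚ._+_ 0ℚ (zipWith (λ a b → toℚ a ℚ.* b) α x)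

-- subsets of B_n are predicates on ℤ^n (required to land in B_n where needed)
Subset : ℕ → Set₁
Subset n = ZVec n → Set

PLC : ∀ {n} → Subset n → Subset n
PLC {n} S β =
  InB β × Σ (List (ℚ × ZVec n)) (λ cs →
    ¬ (cs ≡ []) ×
    All (λ { (c , α) → (0ℚ ℚ.< c) × S α }) cs ×
    toℚv β ≡ lincomb cs)

record SignedPoset (n : ℕ) : Set₁ where
  field
    pred     : Subset n
    inB      : ∀ α → pred α → InB α
    antisym  : ∀ α → pred α → ¬ pred (negᶻ α)
    plc⊆     : ∀ α → PLC pred α → pred α
    ⊆plc     : ∀ α → pred α → PLC pred α

open SignedPoset public

InO : ∀ {n} → SignedPoset n → QVec n → Set
InO {n} P x =
  (∀ α → pred P α → 0ℚ ℚ.≤ ⟨ α , x ⟩)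
  × (∀ (i : Fin n) → (ℚ.- 1ℚ ℚ.≤ lookup x i) × (lookup x i ℚ.≤ 1ℚ))

IsTrit : ℤ → Set
IsTrit z = (z ≡ ℤ.- (ℤ.+ 1)) ⊎ (z ≡ ℤ.+ 0) ⊎ (z ≡ ℤ.+ 1)

SignedFilter : ∀ {n} → SignedPoset n → ZVec n → Set
SignedFilter {n} P f =
  (∀ (i : Fin n) → IsTrit (lookup f i))
  × (∀ α → pred P α → 0ℚ ℚ.≤ ⟨ α , toℚv f ⟩)

coeffSum : ∀ {n} → List (ℚ × ZVec n) → ℚ
coeffSum [] = 0ℚ
coeffSum ((c , _) ∷ rest) = c ℚ.+ coeffSum rest

InConv : ∀ {n} → Subset n → QVec n → Set
InConv {n} F x =
  Σ (List (ℚ × ZVec n)) (λ cs →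
    All (λ { (c , f) → (0ℚ ℚ.≤ c) × F f }) cs ×
    coeffSum cs ≡ 1ℚ ×
    x ≡ lincomb cs)

-- For t > 0 let f_t(x)ᵢ = sign(xᵢ)·[t ≤ ∣xᵢ∣]. The map q ↦ sign(q)·[t ≤ ∣q∣] is odd and
-- monotone, and odd monotone maps preserve every inequality ⟨α, x⟩ ≥ 0 with α = ±eᵢ or
-- ±eᵢ ± eⱼ; so f_t(x) is a signed filter whenever x ∈ O_P. Moreover x = ∫₀¹ f_t(x) dt, and
-- since f_t(x) only changes at the breakpoints ∣xᵢ∣, this integral is the convex combination
-- Σₖ (tₖ - tₖ₋₁) f_{tₖ}(x) over the sorted breakpoints 0 = t₀ ≤ t₁ ≤ ⋯ ≤ tₘ = 1.
-- Conversely O_P is an intersection of half-spaces, hence convex, and contains every signed filter.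

{-# OPTIONS --safe #-}
module Submission where

open import Defs
open import Data.Nat using (ℕ)
open import Data.Fin using (Fin; zero; suc)
open import Data.Integer as ℤ using (ℤ; +_)
import Data.Integer.Properties as ℤP
open import Data.Rational as ℚ using (ℚ; 0ℚ; 1ℚ; _≤_; _<_; _≤?_; _+_; _*_; -_; _-_; ∣_∣; toℚᵘ)
import Data.Rational.Properties as ℚP
import Data.Rational.Unnormalised as ℚᵘ
import Data.Rational.Unnormalised.Properties as ℚᵘP
open import Data.Rational.Solver using (module +-*-Solver)
open import Algebra.Properties.Group ℚP.+-0-group using (⁻¹-involutive)
open import Data.Vec using ([]; _∷_; lookup; tabulate; map)
import Data.Vec.Properties as VecP
open import Data.List as List using (List; []; _∷_)
open import Data.List.Relation.Unary.All as All using (All; []; _∷_)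
open import Data.List.Relation.Unary.All.Properties using (tabulate⁺)
open import Data.List.Relation.Unary.AllPairs using (AllPairs; []; _∷_)
open import Data.List.Relation.Unary.Linked.Properties using (Linked⇒AllPairs)
open import Data.List.Relation.Unary.Any using (here; there)
open import Data.List.Membership.Propositional using (_∈_)
open import Data.List.Membership.Propositional.Properties using (∈-tabulate⁺)
open import Data.List.Relation.Binary.Permutation.Propositional using (↭-sym)
open import Data.List.Relation.Binary.Permutation.Propositional.Properties using (All-resp-↭; ∈-resp-↭)
open import Data.List.Sort ℚP.≤-decTotalOrder using (sort; sort-↭; sort-↗)
open import Data.Product using (_×_; _,_; proj₁; proj₂; map₂)
open import Data.Sum using (inj₁; inj₂)
open import Data.Empty using (⊥-elim)
open import Function using (_∘_)
open import Relation.Nullary using (Dec; yes; no)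
open import Relation.Nullary.Decidable using (from-yes)
open import Relation.Binary using (Tri; tri<; tri≈; tri>; _Preserves_⟶_)
open import Relation.Binary.PropositionalEquality

open +-*-Solver using (solve; _:=_; _:+_; _:*_; _:-_; :-_; con)

toℚᵘ-toℚ : ∀ z → toℚᵘ (toℚ z) ℚᵘ.≃ ℚᵘ.mkℚᵘ z 0
toℚᵘ-toℚ z = ℚP.toℚᵘ-fromℚᵘ (ℚᵘ.mkℚᵘ z 0)

toℚ-+ : ∀ a b → toℚ (a ℤ.+ b) ≡ toℚ a + toℚ b
toℚ-+ a b = ℚP.toℚᵘ-injective (begin
  toℚᵘ (toℚ (a ℤ.+ b))             ≈⟨ toℚᵘ-toℚ (a ℤ.+ b) ⟩
  ℚᵘ.mkℚᵘ (a ℤ.+ b) 0              ≈⟨ ℚᵘ.*≡* (cong (ℤ._* + 1) (cong₂ ℤ._+_ (sym (ℤP.*-identityʳ a)) (sym (ℤP.*-identityʳ b)))) ⟩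
  ℚᵘ.mkℚᵘ a 0 ℚᵘ.+ ℚᵘ.mkℚᵘ b 0    ≈⟨ ℚᵘP.+-cong (toℚᵘ-toℚ a) (toℚᵘ-toℚ b) ⟨
  toℚᵘ (toℚ a) ℚᵘ.+ toℚᵘ (toℚ b)  ≈⟨ ℚP.toℚᵘ-homo-+ (toℚ a) (toℚ b) ⟨
  toℚᵘ (toℚ a + toℚ b)             ∎)
  where open ℚᵘP.≃-Reasoning

toℚ-* : ∀ a b → toℚ (a ℤ.* b) ≡ toℚ a * toℚ b
toℚ-* a b = ℚP.toℚᵘ-injective (begin
  toℚᵘ (toℚ (a ℤ.* b))             ≈⟨ toℚᵘ-toℚ (a ℤ.* b) ⟩
  ℚᵘ.mkℚᵘ (a ℤ.* b) 0              ≈⟨ ℚᵘP.*-cong (toℚᵘ-toℚ a) (toℚᵘ-toℚ b) ⟨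
  toℚᵘ (toℚ a) ℚᵘ.* toℚᵘ (toℚ b)  ≈⟨ ℚP.toℚᵘ-homo-* (toℚ a) (toℚ b) ⟨
  toℚᵘ (toℚ a * toℚ b)             ∎)
  where open ℚᵘP.≃-Reasoning

-1*q≡-q : ∀ q → toℚ (ℤ.- + 1) * q ≡ - q
-1*q≡-q q = trans (sym (ℚP.neg-distribˡ-* 1ℚ q)) (cong -_ (ℚP.*-identityˡ q))

q≡-q⇒q≡0 : ∀ {q} → q ≡ - q → q ≡ 0ℚ
q≡-q⇒q≡0 {q} q≡-q with ℚP.≤-total 0ℚ q
... | inj₁ 0≤q = ℚP.≤-antisym (subst (_≤ 0ℚ) (sym q≡-q) (ℚP.neg-antimono-≤ 0≤q)) 0≤q
... | inj₂ q≤0 = ℚP.≤-antisym q≤0 (subst (0ℚ ≤_) (sym q≡-q) (ℚP.neg-antimono-≤ q≤0))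

0≤p+q⇒-q≤p : ∀ {p q} → 0ℚ ≤ p + q → - q ≤ p
0≤p+q⇒-q≤p {p} {q} 0≤p+q = begin
  - q          ≡⟨ ℚP.+-identityˡ (- q) ⟨
  0ℚ + - q     ≤⟨ ℚP.+-monoˡ-≤ (- q) 0≤p+q ⟩
  p + q + - q  ≡⟨ solve 2 (λ p q → p :+ q :+ (:- q) := p) refl p q ⟩
  p            ∎
  where open ℚP.≤-Reasoning

-q≤p⇒0≤p+q : ∀ {p q} → - q ≤ p → 0ℚ ≤ p + q
-q≤p⇒0≤p+q {p} {q} -q≤p = begin
  0ℚ      ≡⟨ ℚP.+-inverseˡ q ⟨
  - q + q ≤⟨ ℚP.+-monoˡ-≤ q -q≤p ⟩
  p + q   ∎
  where open ℚP.≤-Reasoning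

-1≤-q⇒q≤1 : ∀ {q} → ℚ.- 1ℚ ≤ - q → q ≤ 1ℚ
-1≤-q⇒q≤1 {q} -1≤-q = subst (_≤ 1ℚ) (⁻¹-involutive q) (ℚP.neg-antimono-≤ -1≤-q)

-1≤q≤1⇒∣q∣≤1 : ∀ {q} → ℚ.- 1ℚ ≤ q → q ≤ 1ℚ → ∣ q ∣ ≤ 1ℚ
-1≤q≤1⇒∣q∣≤1 {q} -1≤q q≤1 with ℚP.∣p∣≡p∨∣p∣≡-p q
... | inj₁ ∣q∣≡q  = subst (_≤ 1ℚ) (sym ∣q∣≡q) q≤1
... | inj₂ ∣q∣≡-q = subst (_≤ 1ℚ) (sym ∣q∣≡-q) (ℚP.neg-antimono-≤ -1≤q)

inner-0v : ∀ {n} (α : ZVec n) → ⟨ α , 0v ⟩ ≡ 0ℚ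
inner-0v []      = refl
inner-0v (a ∷ α) = cong₂ _+_ (ℚP.*-zeroʳ (toℚ a)) (inner-0v α)

inner-⊕ : ∀ {n} (α : ZVec n) x y → ⟨ α , x ⊕ y ⟩ ≡ ⟨ α , x ⟩ + ⟨ α , y ⟩
inner-⊕ []      []       []       = refl
inner-⊕ (a ∷ α) (x ∷ xs) (y ∷ ys) = trans (cong (λ p → toℚ a * (x + y) + p) (inner-⊕ α xs ys))
  (solve 5 (λ a x y p q → a :* (x :+ y) :+ (p :+ q) := (a :* x :+ p) :+ (a :* y :+ q)) refl
    (toℚ a) x y ⟨ α , xs ⟩ ⟨ α , ys ⟩)

inner-· : ∀ {n} (α : ZVec n) c x → ⟨ α , c · x ⟩ ≡ c * ⟨ α , x ⟩
inner-· []      c []       = sym (ℚP.*-zeroʳ c)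
inner-· (a ∷ α) c (x ∷ xs) = trans (cong (λ p → toℚ a * (c * x) + p) (inner-· α c xs))
  (solve 4 (λ a c x p → a :* (c :* x) :+ c :* p := c :* (a :* x :+ p)) refl (toℚ a) c x ⟨ α , xs ⟩)

inner-+ᶻ : ∀ {n} (α β : ZVec n) v → ⟨ α +ᶻ β , v ⟩ ≡ ⟨ α , v ⟩ + ⟨ β , v ⟩
inner-+ᶻ []      []      []       = refl
inner-+ᶻ (a ∷ α) (b ∷ β) (x ∷ xs) = trans (cong₂ (λ c p → c * x + p) (toℚ-+ a b) (inner-+ᶻ α β xs))
  (solve 5 (λ a b x p q → (a :+ b) :* x :+ (p :+ q) := (a :* x :+ p) :+ (b :* x :+ q)) refl
    (toℚ a) (toℚ b) x ⟨ α , xs ⟩ ⟨ β , xs ⟩)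

inner-·ᶻ : ∀ {n} s (α : ZVec n) v → ⟨ s ·ᶻ α , v ⟩ ≡ toℚ s * ⟨ α , v ⟩
inner-·ᶻ s []      []       = sym (ℚP.*-zeroʳ (toℚ s))
inner-·ᶻ s (a ∷ α) (x ∷ xs) = trans (cong₂ (λ c p → c * x + p) (toℚ-* s a) (inner-·ᶻ s α xs))
  (solve 4 (λ s a x p → s :* a :* x :+ s :* p := s :* (a :* x :+ p)) refl (toℚ s) (toℚ a) x ⟨ α , xs ⟩)

inner-zeros : ∀ {n} (v : QVec n) → ⟨ tabulate (λ _ → + 0) , v ⟩ ≡ 0ℚ
inner-zeros []       = refl
inner-zeros (x ∷ xs) = cong₂ _+_ (ℚP.*-zeroˡ x) (inner-zeros xs)

inner-e : ∀ {n} (i : Fin n) v → ⟨ e i , v ⟩ ≡ lookup v i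
inner-e zero    (x ∷ xs) = trans (cong₂ _+_ (ℚP.*-identityˡ x) (inner-zeros xs)) (ℚP.+-identityʳ x)
inner-e (suc i) (x ∷ xs) = trans (cong₂ _+_ (ℚP.*-zeroˡ x) (inner-e i xs)) (ℚP.+-identityˡ (lookup xs i))

inner-±e : ∀ {n} s (i : Fin n) v → ⟨ s ·ᶻ e i , v ⟩ ≡ toℚ s * lookup v i
inner-±e s i v = trans (inner-·ᶻ s (e i) v) (cong (toℚ s *_) (inner-e i v))

inner-±e±e : ∀ {n} s u (i j : Fin n) v →
  ⟨ (s ·ᶻ e i) +ᶻ (u ·ᶻ e j) , v ⟩ ≡ toℚ s * lookup v i + toℚ u * lookup v j
inner-±e±e s u i j v = trans (inner-+ᶻ (s ·ᶻ e i) (u ·ᶻ e j) v) (cong₂ _+_ (inner-±e s i v) (inner-±e u j v))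

Weighted : ∀ {n} → (ZVec n → Set) → List (ℚ × ZVec n) → Set
Weighted F = All (λ { (c , f) → 0ℚ ≤ c × F f })

inner-lincomb-≥ : ∀ {n} (β : ZVec n) b cs →
  Weighted (λ f → b ≤ ⟨ β , toℚv f ⟩) cs → b * coeffSum cs ≤ ⟨ β , lincomb cs ⟩
inner-lincomb-≥ β b []             []                   =
  ℚP.≤-reflexive (trans (ℚP.*-zeroʳ b) (sym (inner-0v β)))
inner-lincomb-≥ β b ((c , f) ∷ cs) ((0≤c , b≤βf) ∷ w) = begin
  b * (c + coeffSum cs)                    ≡⟨ ℚP.*-distribˡ-+ b c (coeffSum cs) ⟩
  b * c + b * coeffSum cs                  ≤⟨ ℚP.+-mono-≤ bc≤cβf (inner-lincomb-≥ β b cs w) ⟩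
  c * ⟨ β , toℚv f ⟩ + ⟨ β , lincomb cs ⟩  ≡⟨ cong (_+ ⟨ β , lincomb cs ⟩) (inner-· β c (toℚv f)) ⟨
  ⟨ β , c · toℚv f ⟩ + ⟨ β , lincomb cs ⟩  ≡⟨ inner-⊕ β (c · toℚv f) (lincomb cs) ⟨
  ⟨ β , lincomb ((c , f) ∷ cs) ⟩           ∎
  where
  open ℚP.≤-Reasoning
  bc≤cβf : b * c ≤ c * ⟨ β , toℚv f ⟩
  bc≤cβf = subst (_≤ c * ⟨ β , toℚv f ⟩) (ℚP.*-comm c b)
    (ℚP.*-monoˡ-≤-nonNeg c {{ℚ.nonNegative 0≤c}} b≤βf)

inner-neg-e : ∀ {n} (i : Fin n) v → ⟨ (ℤ.- + 1) ·ᶻ e i , v ⟩ ≡ - lookup v i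
inner-neg-e i v = trans (inner-±e (ℤ.- + 1) i v) (-1*q≡-q (lookup v i))

-- Each constraint of O_P, the box included (xᵢ ≤ 1 as -1 ≤ ⟨-eᵢ, x⟩), is a half-space b ≤ ⟨β, x⟩.
InO-convex : ∀ {n} (P : SignedPoset n) cs →
  Weighted (InO P ∘ toℚv) cs → coeffSum cs ≡ 1ℚ → InO P (lincomb cs)
InO-convex P cs w Σ≡1 = (λ α α∈P → halfspace α 0ℚ (λ v∈O → proj₁ v∈O α α∈P)) , box
  where
  halfspace : ∀ β b → (∀ {v} → InO P v → b ≤ ⟨ β , v ⟩) → b ≤ ⟨ β , lincomb cs ⟩
  halfspace β b valid = subst (_≤ ⟨ β , lincomb cs ⟩) (trans (cong (b *_) Σ≡1) (ℚP.*-identityʳ b))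
    (inner-lincomb-≥ β b cs (All.map (map₂ valid) w))
  box : ∀ i → (ℚ.- 1ℚ ≤ lookup (lincomb cs) i) × (lookup (lincomb cs) i ≤ 1ℚ)
  box i = lower , -1≤-q⇒q≤1 upper
    where
    lower : ℚ.- 1ℚ ≤ lookup (lincomb cs) i
    lower = subst (ℚ.- 1ℚ ≤_) (inner-e i (lincomb cs)) (halfspace (e i) (ℚ.- 1ℚ) λ {v} v∈O →
      subst (ℚ.- 1ℚ ≤_) (sym (inner-e i v)) (proj₁ (proj₂ v∈O i)))
    upper : ℚ.- 1ℚ ≤ - lookup (lincomb cs) i
    upper = subst (ℚ.- 1ℚ ≤_) (inner-neg-e i (lincomb cs)) (halfspace ((ℤ.- + 1) ·ᶻ e i) (ℚ.- 1ℚ) λ {v} v∈O →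
      subst (ℚ.- 1ℚ ≤_) (sym (inner-neg-e i v)) (ℚP.neg-antimono-≤ (proj₂ (proj₂ v∈O i))))

trit-bounds : ∀ {z} → IsTrit z → (ℚ.- 1ℚ ≤ toℚ z) × (toℚ z ≤ 1ℚ)
trit-bounds (inj₁ refl)        = ℚP.≤-refl , from-yes (ℚ.- 1ℚ ≤? 1ℚ)
trit-bounds (inj₂ (inj₁ refl)) = from-yes (ℚ.- 1ℚ ≤? 0ℚ) , from-yes (0ℚ ≤? 1ℚ)
trit-bounds (inj₂ (inj₂ refl)) = from-yes (ℚ.- 1ℚ ≤? 1ℚ) , ℚP.≤-refl

filter∈O : ∀ {n} {P : SignedPoset n} {f} → SignedFilter P f → InO P (toℚv f)
filter∈O {f = f} (trits , cone) = cone , λ i →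
  subst (λ q → (ℚ.- 1ℚ ≤ q) × (q ≤ 1ℚ)) (sym (VecP.lookup-map i toℚ f)) (trit-bounds (trits i))

conv⊆O : ∀ {n} (P : SignedPoset n) {x} → InConv (SignedFilter P) x → InO P x
conv⊆O P (cs , w , Σ≡1 , refl) = InO-convex P cs (All.map (map₂ (filter∈O {P = P})) w) Σ≡1

module OddMonotone (ψ : ℚ → ℚ) (odd : ∀ q → ψ (- q) ≡ - ψ q) (mono : ψ Preserves _≤_ ⟶ _≤_) where

  ψ0≡0 : ψ 0ℚ ≡ 0ℚ
  ψ0≡0 = q≡-q⇒q≡0 (odd 0ℚ)

  nonneg : ∀ {q} → 0ℚ ≤ q → 0ℚ ≤ ψ q
  nonneg {q} 0≤q = subst (_≤ ψ q) ψ0≡0 (mono 0≤q)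

  +-nonneg : ∀ {p q} → 0ℚ ≤ p + q → 0ℚ ≤ ψ p + ψ q
  +-nonneg {p} {q} 0≤p+q = -q≤p⇒0≤p+q (subst (_≤ ψ p) (odd q) (mono (0≤p+q⇒-q≤p 0≤p+q)))

  sign-commute : ∀ {s} → IsSign s → ∀ q → toℚ s * ψ q ≡ ψ (toℚ s * q)
  sign-commute (inj₁ refl) q = trans (ℚP.*-identityˡ (ψ q)) (cong ψ (sym (ℚP.*-identityˡ q)))
  sign-commute (inj₂ refl) q = trans (-1*q≡-q (ψ q)) (trans (sym (odd q)) (cong ψ (sym (-1*q≡-q q))))

  sign-commute-lookup : ∀ {n s} → IsSign s → (x : QVec n) (i : Fin n) →
    toℚ s * lookup (map ψ x) i ≡ ψ (toℚ s * lookup x i)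
  sign-commute-lookup {s = s} ±s x i =
    trans (cong (toℚ s *_) (VecP.lookup-map i ψ x)) (sign-commute ±s (lookup x i))

  cone-preserved : ∀ {n} {α : ZVec n} (x : QVec n) → InB α → 0ℚ ≤ ⟨ α , x ⟩ → 0ℚ ≤ ⟨ α , map ψ x ⟩
  cone-preserved x (inj₁ (i , s , ±s , refl)) 0≤αx =
    subst (0ℚ ≤_) (sym (trans (inner-±e s i (map ψ x)) (sign-commute-lookup ±s x i)))
      (nonneg (subst (0ℚ ≤_) (inner-±e s i x) 0≤αx))
  cone-preserved x (inj₂ (i , j , _ , s , u , ±s , ±u , refl)) 0≤αx =
    subst (0ℚ ≤_) (sym (trans (inner-±e±e s u i j (map ψ x))
                              (cong₂ _+_ (sign-commute-lookup ±s x i) (sign-commute-lookup ±u x j))))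
      (+-nonneg (subst (0ℚ ≤_) (inner-±e±e s u i j x) 0≤αx))

𝟙 : ∀ {A : Set} → Dec A → ℤ
𝟙 (yes _) = + 1
𝟙 (no _)  = + 0

𝟙[_≤_] : ℚ → ℚ → ℤ
𝟙[ t ≤ q ] = 𝟙 (t ≤? q)

𝟙-mono : ∀ t → (λ q → toℚ 𝟙[ t ≤ q ]) Preserves _≤_ ⟶ _≤_
𝟙-mono t {q} {r} q≤r with t ≤? q | t ≤? r
... | yes _   | yes _  = ℚP.≤-refl
... | yes t≤q | no t≰r = ⊥-elim (t≰r (ℚP.≤-trans t≤q q≤r))
... | no _    | yes _  = from-yes (0ℚ ≤? 1ℚ)
... | no _    | no _   = ℚP.≤-refl

𝟙-yes : ∀ {t v} → t ≤ v → toℚ 𝟙[ t ≤ v ] ≡ 1ℚ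
𝟙-yes {t} {v} t≤v with t ≤? v
... | yes _  = refl
... | no t≰v = ⊥-elim (t≰v t≤v)

-- sign(q)·[t ≤ ∣q∣] for t > 0, written as a difference of indicators so that it is odd and
-- monotone in q for every t, including the breakpoint t = 0 (present when some xᵢ = 0).
threshold : ℚ → ℚ → ℤ
threshold t q = 𝟙[ t ≤ q ] ℤ.- 𝟙[ t ≤ - q ]

threshold-trit : ∀ t q → IsTrit (threshold t q)
threshold-trit t q with t ≤? q | t ≤? - q
... | yes _ | yes _ = inj₂ (inj₁ refl)
... | yes _ | no _  = inj₂ (inj₂ refl)
... | no _  | yes _ = inj₁ refl
... | no _  | no _  = inj₂ (inj₁ refl)

toℚ-threshold : ∀ t q → toℚ (threshold t q) ≡ toℚ 𝟙[ t ≤ q ] - toℚ 𝟙[ t ≤ - q ]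
toℚ-threshold t q with t ≤? q | t ≤? - q
... | yes _ | yes _ = refl
... | yes _ | no _  = refl
... | no _  | yes _ = refl
... | no _  | no _  = refl

threshold-odd : ∀ t q → toℚ (threshold t (- q)) ≡ - toℚ (threshold t q)
threshold-odd t q = begin
  toℚ (threshold t (- q))                        ≡⟨ toℚ-threshold t (- q) ⟩
  toℚ 𝟙[ t ≤ - q ] - toℚ 𝟙[ t ≤ - - q ]          ≡⟨ cong (λ r → toℚ 𝟙[ t ≤ - q ] - toℚ 𝟙[ t ≤ r ]) (⁻¹-involutive q) ⟩
  toℚ 𝟙[ t ≤ - q ] - toℚ 𝟙[ t ≤ q ]              ≡⟨ solve 2 (λ a b → b :- a := :- (a :- b)) refl (toℚ 𝟙[ t ≤ q ]) (toℚ 𝟙[ t ≤ - q ]) ⟩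
  - (toℚ 𝟙[ t ≤ q ] - toℚ 𝟙[ t ≤ - q ])          ≡⟨ cong -_ (toℚ-threshold t q) ⟨
  - toℚ (threshold t q)                          ∎
  where open ≡-Reasoning

threshold-mono : ∀ t → (toℚ ∘ threshold t) Preserves _≤_ ⟶ _≤_
threshold-mono t {q} {r} q≤r = begin
  toℚ (threshold t q)                    ≡⟨ toℚ-threshold t q ⟩
  toℚ 𝟙[ t ≤ q ] - toℚ 𝟙[ t ≤ - q ]      ≤⟨ ℚP.+-mono-≤ (𝟙-mono t q≤r) (ℚP.neg-antimono-≤ (𝟙-mono t (ℚP.neg-antimono-≤ q≤r))) ⟩
  toℚ 𝟙[ t ≤ r ] - toℚ 𝟙[ t ≤ - r ]      ≡⟨ toℚ-threshold t r ⟨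
  toℚ (threshold t r)                    ∎
  where open ℚP.≤-Reasoning

threshold-filter : ∀ {n} (P : SignedPoset n) {x} → (∀ α → pred P α → 0ℚ ≤ ⟨ α , x ⟩) →
  ∀ t → SignedFilter P (map (threshold t) x)
threshold-filter P {x} cone t =
  (λ i → subst IsTrit (sym (VecP.lookup-map i (threshold t) x)) (threshold-trit t (lookup x i))) ,
  (λ α α∈P → subst (λ v → 0ℚ ≤ ⟨ α , v ⟩) (VecP.map-∘ toℚ (threshold t) x)
                   (cone-preserved x (inB P α α∈P) (cone α α∈P)))
  where open OddMonotone (toℚ ∘ threshold t) (threshold-odd t) (threshold-mono t)

riemannSum : (ℚ → ℚ) → ℚ → List ℚ → ℚ
riemannSum g a []       = 0ℚ
riemannSum g a (t ∷ ts) = (t - a) * g t + riemannSum g t ts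

riemannSum-cong : ∀ {g h a ts} → All (λ t → g t ≡ h t) ts → riemannSum g a ts ≡ riemannSum h a ts
riemannSum-cong                 []             = refl
riemannSum-cong {a = a} {t ∷ _} (gt≡ht ∷ g≗h) = cong₂ _+_ (cong ((t - a) *_) gt≡ht) (riemannSum-cong g≗h)

riemannSum-sub : ∀ g h a ts → riemannSum (λ t → g t - h t) a ts ≡ riemannSum g a ts - riemannSum h a ts
riemannSum-sub g h a []       = refl
riemannSum-sub g h a (t ∷ ts) = trans (cong (λ r → (t - a) * (g t - h t) + r) (riemannSum-sub g h t ts))
  (solve 5 (λ d x y p q → d :* (x :- y) :+ (p :- q) := (d :* x :+ p) :- (d :* y :+ q)) refl
    (t - a) (g t) (h t) (riemannSum g t ts) (riemannSum h t ts))

riemannSum-𝟙-below : ∀ {v} a {ts} → All (v <_) ts → riemannSum (λ t → toℚ 𝟙[ t ≤ v ]) a ts ≡ 0ℚ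
riemannSum-𝟙-below a []                         = refl
riemannSum-𝟙-below {v} a {t ∷ _} (v<t ∷ v<ts) with t ≤? v
... | yes t≤v = ⊥-elim (ℚP.<-irrefl refl (ℚP.<-≤-trans v<t t≤v))
... | no _    = cong₂ _+_ (ℚP.*-zeroʳ (t - a)) (riemannSum-𝟙-below t v<ts)

riemannSum-𝟙-∈ : ∀ {a v} ts → AllPairs _≤_ (a ∷ ts) → v ∈ a ∷ ts →
  riemannSum (λ t → toℚ 𝟙[ t ≤ v ]) a ts ≡ v - a
riemannSum-𝟙-∈ {a} [] _ (here refl) = sym (ℚP.+-inverseʳ a)
riemannSum-𝟙-∈ {a} {v} (t ∷ ts) ((a≤t ∷ _) ∷ sorted@(t≤ts ∷ _)) v∈a∷t∷ts with t ≤? v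
... | yes t≤v = begin
  (t - a) * 1ℚ + riemannSum (λ t → toℚ 𝟙[ t ≤ v ]) t ts
    ≡⟨ cong (λ r → (t - a) * 1ℚ + r) (riemannSum-𝟙-∈ ts sorted (drop-a v∈a∷t∷ts)) ⟩
  (t - a) * 1ℚ + (v - t)
    ≡⟨ solve 3 (λ a t v → (t :- a) :* con 1ℚ :+ (v :- t) := v :- a) refl a t v ⟩
  v - a ∎
  where
  open ≡-Reasoning
  drop-a : v ∈ a ∷ t ∷ ts → v ∈ t ∷ ts
  drop-a (here v≡a) = here (sym (ℚP.≤-antisym t≤v (subst (_≤ t) (sym v≡a) a≤t)))
  drop-a (there v∈) = v∈
... | no t≰v with v∈a∷t∷ts
...   | here refl =
  trans (cong₂ _+_ (ℚP.*-zeroʳ (t - a)) (riemannSum-𝟙-below t (All.map (ℚP.<-≤-trans (ℚP.≰⇒> t≰v)) t≤ts)))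
        (sym (ℚP.+-inverseʳ a))
...   | there (here refl)  = ⊥-elim (t≰v ℚP.≤-refl)
...   | there (there v∈ts) = ⊥-elim (t≰v (All.lookup t≤ts v∈ts))

riemannSum-threshold : ∀ {q} ts → AllPairs _≤_ (0ℚ ∷ ts) → ∣ q ∣ ∈ ts →
  riemannSum (λ t → toℚ (threshold t q)) 0ℚ ts ≡ q
riemannSum-threshold {q} ts sorted@(0≤ts ∷ _) ∣q∣∈ts = begin
  riemannSum (λ t → toℚ (threshold t q)) 0ℚ ts
    ≡⟨ riemannSum-cong (All.universal (λ t → toℚ-threshold t q) ts) ⟩
  riemannSum (λ t → toℚ 𝟙[ t ≤ q ] - toℚ 𝟙[ t ≤ - q ]) 0ℚ ts
    ≡⟨ riemannSum-sub (λ t → toℚ 𝟙[ t ≤ q ]) (λ t → toℚ 𝟙[ t ≤ - q ]) 0ℚ ts ⟩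
  S q - S (- q)
    ≡⟨ by-sign (ℚP.<-cmp 0ℚ q) ⟩
  q ∎
  where
  open ≡-Reasoning
  S : ℚ → ℚ
  S v = riemannSum (λ t → toℚ 𝟙[ t ≤ v ]) 0ℚ ts
  S-neg : ∀ {v} → v < 0ℚ → S v ≡ 0ℚ
  S-neg v<0 = riemannSum-𝟙-below 0ℚ (All.map (ℚP.<-≤-trans v<0) 0≤ts)
  S-∈ : ∀ {v} → v ∈ ts → S v ≡ v
  S-∈ {v} v∈ts = trans (riemannSum-𝟙-∈ ts sorted (there v∈ts)) (ℚP.+-identityʳ v)
  by-sign : Tri (0ℚ < q) (0ℚ ≡ q) (q < 0ℚ) → S q - S (- q) ≡ q
  by-sign (tri< 0<q _ _) = trans (cong₂ _-_ (S-∈ q∈ts) (S-neg (ℚP.neg-antimono-< 0<q))) (ℚP.+-identityʳ q)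
    where q∈ts = subst (_∈ ts) (ℚP.0≤p⇒∣p∣≡p (ℚP.<⇒≤ 0<q)) ∣q∣∈ts
  by-sign (tri≈ _ refl _) = ℚP.+-inverseʳ (S 0ℚ)
  by-sign (tri> _ _ q<0) =
    trans (cong₂ _-_ (S-neg q<0) (S-∈ -q∈ts)) (trans (ℚP.+-identityˡ (- - q)) (⁻¹-involutive q))
    where -q∈ts = subst (_∈ ts) (trans (sym (ℚP.∣-p∣≡∣p∣ q)) (ℚP.0≤p⇒∣p∣≡p (ℚP.<⇒≤ (ℚP.neg-antimono-< q<0)))) ∣q∣∈ts

layers : ∀ {n} → QVec n → ℚ → List ℚ → List (ℚ × ZVec n)
layers x a []       = []
layers x a (t ∷ ts) = (t - a , map (threshold t) x) ∷ layers x t ts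

layers-weighted : ∀ {n} {F : ZVec n → Set} (x : QVec n) → (∀ t → F (map (threshold t) x)) →
  ∀ {a} ts → AllPairs _≤_ (a ∷ ts) → Weighted F (layers x a ts)
layers-weighted x F-layer []       _                       = []
layers-weighted x F-layer {a} (t ∷ ts) ((a≤t ∷ _) ∷ sorted) =
  (0≤t-a , F-layer t) ∷ layers-weighted x F-layer ts sorted
  where
  0≤t-a : 0ℚ ≤ t - a
  0≤t-a = subst (_≤ t - a) (ℚP.+-inverseʳ a) (ℚP.+-monoˡ-≤ (- a) a≤t)

coeffSum-layers : ∀ {n} (x : QVec n) a ts → coeffSum (layers x a ts) ≡ riemannSum (λ _ → 1ℚ) a ts
coeffSum-layers x a []       = refl
coeffSum-layers x a (t ∷ ts) = cong₂ _+_ (sym (ℚP.*-identityʳ (t - a))) (coeffSum-layers x t ts)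

lookup-lincomb-layers : ∀ {n} (x : QVec n) i a ts →
  lookup (lincomb (layers x a ts)) i ≡ riemannSum (λ t → toℚ (threshold t (lookup x i))) a ts
lookup-lincomb-layers x i a []       = VecP.lookup-replicate i 0ℚ
lookup-lincomb-layers x i a (t ∷ ts) =
  trans (VecP.lookup-zipWith _+_ i ((t - a) · toℚv f) (lincomb (layers x t ts)))
        (cong₂ _+_ layer-coordinate (lookup-lincomb-layers x i t ts))
  where
  f = map (threshold t) x
  layer-coordinate : lookup ((t - a) · toℚv f) i ≡ (t - a) * toℚ (threshold t (lookup x i))
  layer-coordinate = trans (VecP.lookup-map i ((t - a) *_) (toℚv f))
    (cong ((t - a) *_) (trans (VecP.lookup-map i toℚ f) (cong toℚ (VecP.lookup-map i (threshold t) x))))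

breakpoints : ∀ {n} → QVec n → List ℚ
breakpoints x = 1ℚ ∷ List.tabulate (λ i → ∣ lookup x i ∣)

O⊆conv : ∀ {n} (P : SignedPoset n) {x} → InO P x → InConv (SignedFilter P) x
O⊆conv P {x} (cone , box) =
  layers x 0ℚ ts , layers-weighted x (threshold-filter P cone) ts sorted , Σ≡1 , x≡lincomb
  where
  ts = sort (breakpoints x)
  ts↭ = ↭-sym (sort-↭ (breakpoints x))
  sorted : AllPairs _≤_ (0ℚ ∷ ts)
  sorted = All-resp-↭ ts↭ (from-yes (0ℚ ≤? 1ℚ) ∷ tabulate⁺ (λ i → ℚP.0≤∣p∣ (lookup x i)))
         ∷ Linked⇒AllPairs ℚP.≤-trans (sort-↗ (breakpoints x))
  ts≤1 : All (_≤ 1ℚ) ts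
  ts≤1 = All-resp-↭ ts↭ (ℚP.≤-refl ∷ tabulate⁺ (λ i → -1≤q≤1⇒∣q∣≤1 (proj₁ (box i)) (proj₂ (box i))))
  Σ≡1 : coeffSum (layers x 0ℚ ts) ≡ 1ℚ
  Σ≡1 = begin
    coeffSum (layers x 0ℚ ts)                 ≡⟨ coeffSum-layers x 0ℚ ts ⟩
    riemannSum (λ _ → 1ℚ) 0ℚ ts               ≡⟨ riemannSum-cong (All.map (sym ∘ 𝟙-yes) ts≤1) ⟩
    riemannSum (λ t → toℚ 𝟙[ t ≤ 1ℚ ]) 0ℚ ts  ≡⟨ riemannSum-𝟙-∈ ts sorted (there (∈-resp-↭ ts↭ (here refl))) ⟩
    1ℚ - 0ℚ                                   ∎
    where open ≡-Reasoning
  coordinate : ∀ i → lookup (lincomb (layers x 0ℚ ts)) i ≡ lookup x i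
  coordinate i = trans (lookup-lincomb-layers x i 0ℚ ts)
    (riemannSum-threshold ts sorted (∈-resp-↭ ts↭ (there (∈-tabulate⁺ i))))
  x≡lincomb : x ≡ lincomb (layers x 0ℚ ts)
  x≡lincomb = begin
    x                                            ≡⟨ VecP.tabulate∘lookup x ⟨
    tabulate (lookup x)                          ≡⟨ VecP.tabulate-cong (sym ∘ coordinate) ⟩
    tabulate (lookup (lincomb (layers x 0ℚ ts))) ≡⟨ VecP.tabulate∘lookup _ ⟩
    lincomb (layers x 0ℚ ts)                     ∎
    where open ≡-Reasoning

proposition3p8 : ∀ (n : ℕ) (P : SignedPoset n) (x : QVec n) →
    (InO P x → InConv (SignedFilter P) x) × (InConv (SignedFilter P) x → InO P x)
proposition3p8 n P x = O⊆conv P , conv⊆O P
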